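{- Let $(\mathcal{C},\Omega,\mathfrak{P})$ be a spined category, let $S$ be a set and $f:S\to\mathrm{Ob}(\mathcal{C})$ a function such that (1) for every $n\in\mathbb{N}$ there is $X\in S$ with $f(X)=\Omega_n$, and (2) for every span $f(X)\xleftarrow{x}\Omega_n\xrightarrow{y}f(Y)$ in $\mathcal{C}$ there is a distinguished element $Z_{x,y}\in S$ with $f(Z_{x,y})=\mathfrak{P}(x,y)$. Then there exist a sequence of objects $\Omega^S$ and a proxy pushout operation $\mathfrak{P}^S$ on $S_{\downarrow f}$ such that: $(S_{\downarrow f},\Omega^S,\mathfrak{P}^S)$ is a spined category; $f$ (acting as the identity on morphisms) is a spinal functor $(S_{\downarrow f},\Omega^S,\mathfrak{P}^S)\to(\mathcal{C},\Omega,\mathfrak{P})$; and if $(\mathcal{C},\Omega,\mathfrak{P})$ is measurable then so is $(S_{\downarrow f},\Omega^S,\mathfrak{P}^S)$.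
   Context: $S_{\downarrow f}$ is the category with object set $S$ and $\mathrm{Hom}_{S_{\downarrow f}}(A,B)=\mathrm{Hom}_{\mathcal{C}}(f(A),f(B))$, with composition and identities from $\mathcal{C}$. A spined category is a triple $(\mathcal{C},\Omega,\mathfrak{P})$: a category, a sequence of objects $(\Omega_n)_{n\in\mathbb{N}}$, and an operation $\mathfrak{P}$ assigning to each span $G\xleftarrow{g}\Omega_n\xrightarrow{h}H$ an object $\mathfrak{P}(g,h)$ and morphisms $\mathfrak{P}(g,h)_g:G\to\mathfrak{P}(g,h)$, $\mathfrak{P}(g,h)_h:H\to\mathfrak{P}(g,h)$ with $\mathfrak{P}(g,h)_gg=\mathfrak{P}(g,h)_hh$, such that (SC1) every object has a morphism to some $\Omega_n$; (SC2) for every such span and all $g':G\to G'$, $h':H\to H'$ there is a unique $(g',h'):\mathfrak{P}(g,h)\to\mathfrak{P}(g'g,h'h)$ with $(g',h')\mathfrak{P}(g,h)_g=\mathfrak{P}(g'g,h'h)_{g'g}g'$ and $(g',h')\mathfrak{P}(g,h)_h=\mathfrak{P}(g'g,h'h)_{h'h}h'$. A spinal functor $F:(\mathcal{C},\Omega^{\mathcal C},\mathfrak{P}^{\mathcal C})\to(\mathcal{D},\Omega^{\mathcal D},\mathfrak{P}^{\mathcal D})$ is a functor with $F(\Omega^{\mathcal C}_n)=\Omega^{\mathcal D}_n$ for all $n$ and, for every span, $F(\mathfrak{P}^{\mathcal C}(g,h))=\mathfrak{P}^{\mathcal D}(Fg,Fh)$, $F(\mathfrak{P}^{\mathcal C}(g,h)_g)=\mathfrak{P}^{\mathcal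 D}(Fg,Fh)_{Fg}$, $F(\mathfrak{P}^{\mathcal C}(g,h)_h)=\mathfrak{P}^{\mathcal D}(Fg,Fh)_{Fh}$. An S-functor is a spinal functor to the spined category $\mathbf{Nat}$ = the poset $(\mathbb{N},\le)$ with $\Omega_n=n$ and proxy pushouts given by maxima; a spined category is measurable if it admits an S-functor. -}

module Defs where

open import Level using (Level; _⊔_) renaming (suc to lsuc; zero to lzero)
open import Data.Nat using (ℕ; _≤_) renaming (_⊔_ to _⊔ℕ_)
open import Data.Nat.Properties using (≤-refl; ≤-trans; ≤-irrelevant; m≤m⊔n; m≤n⊔m; ⊔-mono-≤)
open import Data.Product using (Σ; _×_; _,_; ∃!)
open import Relation.Binary.PropositionalEquality using (_≡_; refl; subst)

record Category (o ℓ : Level) : Set (lsuc (o ⊔ ℓ)) where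
  infixr 9 _∘_
  field
    Obj  : Set o
    Hom  : Obj → Obj → Set ℓ
    id   : ∀ {A} → Hom A A
    _∘_  : ∀ {A B C} → Hom B C → Hom A B → Hom A C
    assoc : ∀ {A B C D} (h : Hom C D) (g : Hom B C) (f : Hom A B) →
            (h ∘ g) ∘ f ≡ h ∘ (g ∘ f)
    identityˡ : ∀ {A B} (f : Hom A B) → id ∘ f ≡ f
    identityʳ : ∀ {A B} (f : Hom A B) → f ∘ id ≡ f

record Functor {o ℓ o' ℓ'} (C : Category o ℓ) (D : Category o' ℓ')
       : Set (o ⊔ ℓ ⊔ o' ⊔ ℓ') where
  private
    module C = Category C
    module D = Category D
  field
    F₀ : C.Obj → D.Obj
    F₁ : ∀ {A B} → C.Hom A B → D.Hom (F₀ A) (F₀ B)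
    F-id : ∀ {A} → F₁ (C.id {A}) ≡ D.id
    F-∘  : ∀ {A B E} (g : C.Hom B E) (f : C.Hom A B) →
           F₁ (g C.∘ f) ≡ F₁ g D.∘ F₁ f

record Spine {o ℓ} (C : Category o ℓ) : Set (o ⊔ ℓ) where
  open Category C
  field
    Ω   : ℕ → Obj
    𝔓   : ∀ {n G H} → Hom (Ω n) G → Hom (Ω n) H → Obj
    𝔓ₗ  : ∀ {n G H} (g : Hom (Ω n) G) (h : Hom (Ω n) H) → Hom G (𝔓 g h)
    𝔓ᵣ  : ∀ {n G H} (g : Hom (Ω n) G) (h : Hom (Ω n) H) → Hom H (𝔓 g h)
    𝔓-comm : ∀ {n G H} (g : Hom (Ω n) G) (h : Hom (Ω n) H) →
             𝔓ₗ g h ∘ g ≡ 𝔓ᵣ g h ∘ h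
    SC1 : ∀ (X : Obj) → Σ ℕ λ n → Hom X (Ω n)
    SC2 : ∀ {n G H G' H'} (g : Hom (Ω n) G) (h : Hom (Ω n) H)
            (g' : Hom G G') (h' : Hom H H') →
          ∃! _≡_ (λ (u : Hom (𝔓 g h) (𝔓 (g' ∘ g) (h' ∘ h))) →
                   (u ∘ 𝔓ₗ g h ≡ 𝔓ₗ (g' ∘ g) (h' ∘ h) ∘ g')
                 × (u ∘ 𝔓ᵣ g h ≡ 𝔓ᵣ (g' ∘ g) (h' ∘ h) ∘ h'))

record SpinedCategory (o ℓ : Level) : Set (lsuc (o ⊔ ℓ)) where
  field
    cat   : Category o ℓ
    spine : Spine cat

-- Spinal functors.  Object equalities are strict (≡), so morphisms are
-- transported along them with subst.

record IsSpinal {o ℓ o' ℓ'} {C : Category o ℓ} {D : Category o' ℓ'}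
       (SC : Spine C) (SD : Spine D) (F : Functor C D)
       : Set (o ⊔ ℓ ⊔ o' ⊔ ℓ') where
  private
    module C = Category C
    module D = Category D
    module SC = Spine SC
    module SD = Spine SD
  open Functor F
  field
    F-Ω : ∀ n → F₀ (SC.Ω n) ≡ SD.Ω n
  F₁Ω : ∀ {n G} → C.Hom (SC.Ω n) G → D.Hom (SD.Ω n) (F₀ G)
  F₁Ω {n} {G} g = subst (λ X → D.Hom X (F₀ G)) (F-Ω n) (F₁ g)
  field
    F-𝔓  : ∀ {n G H} (g : C.Hom (SC.Ω n) G) (h : C.Hom (SC.Ω n) H) →
           F₀ (SC.𝔓 g h) ≡ SD.𝔓 (F₁Ω g) (F₁Ω h)
    F-𝔓ₗ : ∀ {n G H} (g : C.Hom (SC.Ω n) G) (h : C.Hom (SC.Ω n) H) →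
           subst (D.Hom (F₀ G)) (F-𝔓 g h) (F₁ (SC.𝔓ₗ g h))
             ≡ SD.𝔓ₗ (F₁Ω g) (F₁Ω h)
    F-𝔓ᵣ : ∀ {n G H} (g : C.Hom (SC.Ω n) G) (h : C.Hom (SC.Ω n) H) →
           subst (D.Hom (F₀ H)) (F-𝔓 g h) (F₁ (SC.𝔓ᵣ g h))
             ≡ SD.𝔓ᵣ (F₁Ω g) (F₁Ω h)

record SpinalFunctor {o ℓ o' ℓ'} {C : Category o ℓ} {D : Category o' ℓ'}
       (SC : Spine C) (SD : Spine D) : Set (o ⊔ ℓ ⊔ o' ⊔ ℓ') where
  field
    functor  : Functor C D
    isSpinal : IsSpinal SC SD functor

NatCat : Category lzero lzero
NatCat = record
  { Obj = ℕ ; Hom = _≤_ ; id = ≤-refl ; _∘_ = λ g f → ≤-trans f g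
  ; assoc = λ _ _ _ → ≤-irrelevant _ _
  ; identityˡ = λ _ → ≤-irrelevant _ _
  ; identityʳ = λ _ → ≤-irrelevant _ _ }

NatSpine : Spine NatCat
NatSpine = record
  { Ω = λ n → n
  ; 𝔓 = λ {_} {G} {H} _ _ → G ⊔ℕ H
  ; 𝔓ₗ = λ {_} {G} {H} _ _ → m≤m⊔n G H
  ; 𝔓ᵣ = λ {_} {G} {H} _ _ → m≤n⊔m G H
  ; 𝔓-comm = λ _ _ → ≤-irrelevant _ _
  ; SC1 = λ X → X , ≤-refl
  ; SC2 = λ g h g' h' → ⊔-mono-≤ g' h'
                      , (≤-irrelevant _ _ , ≤-irrelevant _ _)
                      , λ _ → ≤-irrelevant _ _ }

SFunctor : ∀ {o ℓ} {C : Category o ℓ} → Spine C → Set (o ⊔ ℓ)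
SFunctor SC = SpinalFunctor SC NatSpine

Measurable : ∀ {o ℓ} {C : Category o ℓ} → Spine C → Set (o ⊔ ℓ)
Measurable SC = SFunctor SC

_↓_ : ∀ {o ℓ s} (C : Category o ℓ) {S : Set s} → (S → Category.Obj C) →
      Category s ℓ
_↓_ C {S} f = record
  { Obj = S ; Hom = λ A B → Hom (f A) (f B) ; id = id ; _∘_ = _∘_
  ; assoc = assoc ; identityˡ = identityˡ ; identityʳ = identityʳ }
  where open Category C

↓-functor : ∀ {o ℓ s} (C : Category o ℓ) {S : Set s}
            (f : S → Category.Obj C) → Functor (C ↓ f) C
↓-functor C f = record { F₀ = f ; F₁ = λ x → x ; F-id = refl ; F-∘ = λ _ _ → refl }

module Submission where

-- Objects of C ↓ f carry the hom-sets of C, so the spine of C lifts by choosing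
-- preimages under f: Ω^S n is the given preimage of Ω n and 𝔓^S(x, y) is Z x y,
-- with the legs of 𝔓(x, y) retyped along f (Z x y) ≡ 𝔓(x, y).  Every axiom of
-- the lifted spine is then the corresponding axiom of C, transported along
-- these object equalities, and f is spinal by construction.  Measurability
-- is inherited because an S-functor precomposed with a spinal functor is an
-- S-functor, the proxy pushouts of Nat depending only on the objects.

open import Defs
open import Data.Nat using (ℕ)
open import Data.Nat.Properties using (≤-irrelevant)
open import Data.Product using (Σ; _×_; _,_; proj₁; proj₂; ∃!)
open import Relation.Binary.PropositionalEquality
  using (_≡_; refl; sym; trans; cong; subst; subst₂)
open import Relation.Binary.PropositionalEquality.Properties using (subst-subst-sym)

module Retyping {o ℓ} (C : Category o ℓ) where
  open Category C

  subst-dom-∘ : ∀ {A A' B D} (p : A ≡ A') (k : Hom B D) (g : Hom A B) →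
                subst (λ X → Hom X D) p (k ∘ g) ≡ k ∘ subst (λ X → Hom X B) p g
  subst-dom-∘ refl k g = refl

  retype-commuting-square :
    ∀ {A A' G H P P'} (p : A ≡ A') (q : P' ≡ P)
      (g : Hom A G) (h : Hom A H) (a : Hom G P) (b : Hom H P) →
    a ∘ subst (λ X → Hom X G) p g ≡ b ∘ subst (λ X → Hom X H) p h →
    subst (Hom G) (sym q) a ∘ g ≡ subst (Hom H) (sym q) b ∘ h
  retype-commuting-square refl refl g h a b square = square

  retype-∃!-mediator :
    ∀ {G G' H H' P P' Q Q'} (p : P' ≡ P) (q : Q' ≡ Q)
      (lP : Hom G P) (rP : Hom H P) (lQ : Hom G' Q) (rQ : Hom H' Q)
      (g' : Hom G G') (h' : Hom H H') →
    ∃! _≡_ (λ (u : Hom P Q) → (u ∘ lP ≡ lQ ∘ g') × (u ∘ rP ≡ rQ ∘ h')) →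
    ∃! _≡_ (λ (u : Hom P' Q') →
        (u ∘ subst (Hom G) (sym p) lP ≡ subst (Hom G') (sym q) lQ ∘ g')
      × (u ∘ subst (Hom H) (sym p) rP ≡ subst (Hom H') (sym q) rQ ∘ h'))
  retype-∃!-mediator refl refl lP rP lQ rQ g' h' mediator = mediator

module Lift {o ℓ s} (C : Category o ℓ) (SC : Spine C)
    (S : Set s) (f : S → Category.Obj C)
    (Ω-preimage : ∀ (n : ℕ) → Σ S λ X → f X ≡ Spine.Ω SC n)
    (Z : ∀ {n X Y} (x : Category.Hom C (Spine.Ω SC n) (f X))
           (y : Category.Hom C (Spine.Ω SC n) (f Y)) → S)
    (f-Z : ∀ {n X Y} (x : Category.Hom C (Spine.Ω SC n) (f X))
             (y : Category.Hom C (Spine.Ω SC n) (f Y)) →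
           f (Z x y) ≡ Spine.𝔓 SC x y) where
  open Category C
  open Retyping C
  module SC = Spine SC

  Ωˢ : ℕ → S
  Ωˢ n = proj₁ (Ω-preimage n)

  f-Ωˢ : ∀ n → f (Ωˢ n) ≡ SC.Ω n
  f-Ωˢ n = proj₂ (Ω-preimage n)

  fromΩˢ : ∀ {n G} → Hom (f (Ωˢ n)) G → Hom (SC.Ω n) G
  fromΩˢ {n} {G} = subst (λ X → Hom X G) (f-Ωˢ n)

  𝔓ˢ : ∀ {n G H} → Hom (f (Ωˢ n)) (f G) → Hom (f (Ωˢ n)) (f H) → S
  𝔓ˢ g h = Z (fromΩˢ g) (fromΩˢ h)

  f-𝔓ˢ : ∀ {n G H} (g : Hom (f (Ωˢ n)) (f G)) (h : Hom (f (Ωˢ n)) (f H)) →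
         f (𝔓ˢ g h) ≡ SC.𝔓 (fromΩˢ g) (fromΩˢ h)
  f-𝔓ˢ g h = f-Z (fromΩˢ g) (fromΩˢ h)

  𝔓ˢₗ : ∀ {n G H} (g : Hom (f (Ωˢ n)) (f G)) (h : Hom (f (Ωˢ n)) (f H)) →
        Hom (f G) (f (𝔓ˢ g h))
  𝔓ˢₗ g h = subst (Hom _) (sym (f-𝔓ˢ g h)) (SC.𝔓ₗ (fromΩˢ g) (fromΩˢ h))

  𝔓ˢᵣ : ∀ {n G H} (g : Hom (f (Ωˢ n)) (f G)) (h : Hom (f (Ωˢ n)) (f H)) →
        Hom (f H) (f (𝔓ˢ g h))
  𝔓ˢᵣ g h = subst (Hom _) (sym (f-𝔓ˢ g h)) (SC.𝔓ᵣ (fromΩˢ g) (fromΩˢ h))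

  𝔓ˢ-comm : ∀ {n G H} (g : Hom (f (Ωˢ n)) (f G)) (h : Hom (f (Ωˢ n)) (f H)) →
            𝔓ˢₗ g h ∘ g ≡ 𝔓ˢᵣ g h ∘ h
  𝔓ˢ-comm {n} g h = retype-commuting-square (f-Ωˢ n) (f-𝔓ˢ g h) g h _ _
                      (SC.𝔓-comm (fromΩˢ g) (fromΩˢ h))

  SC1ˢ : ∀ X → Σ ℕ λ n → Hom (f X) (f (Ωˢ n))
  SC1ˢ X with SC.SC1 (f X)
  ... | n , toΩ = n , subst (Hom (f X)) (sym (f-Ωˢ n)) toΩ

  SC2ˢ : ∀ {n G H G' H'} (g : Hom (f (Ωˢ n)) (f G)) (h : Hom (f (Ωˢ n)) (f H))
           (g' : Hom (f G) (f G')) (h' : Hom (f H) (f H')) →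
         ∃! _≡_ (λ (u : Hom (f (𝔓ˢ g h)) (f (𝔓ˢ (g' ∘ g) (h' ∘ h)))) →
                  (u ∘ 𝔓ˢₗ g h ≡ 𝔓ˢₗ (g' ∘ g) (h' ∘ h) ∘ g')
                × (u ∘ 𝔓ˢᵣ g h ≡ 𝔓ˢᵣ (g' ∘ g) (h' ∘ h) ∘ h'))
  SC2ˢ {n} {G' = G'} {H'} g h g' h' =
    retype-∃!-mediator (f-𝔓ˢ g h) (f-𝔓ˢ (g' ∘ g) (h' ∘ h)) _ _ _ _ g' h'
      (subst₂ mediates (sym (subst-dom-∘ (f-Ωˢ n) g' g))
                       (sym (subst-dom-∘ (f-Ωˢ n) h' h))
              (SC.SC2 (fromΩˢ g) (fromΩˢ h) g' h'))
    where
    mediates : Hom (SC.Ω n) (f G') → Hom (SC.Ω n) (f H') → Set ℓ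
    mediates k₁ k₂ =
      ∃! _≡_ (λ (u : Hom (SC.𝔓 (fromΩˢ g) (fromΩˢ h)) (SC.𝔓 k₁ k₂)) →
               (u ∘ SC.𝔓ₗ (fromΩˢ g) (fromΩˢ h) ≡ SC.𝔓ₗ k₁ k₂ ∘ g')
             × (u ∘ SC.𝔓ᵣ (fromΩˢ g) (fromΩˢ h) ≡ SC.𝔓ᵣ k₁ k₂ ∘ h'))

  lifted-spine : Spine (C ↓ f)
  lifted-spine = record
    { Ω = Ωˢ ; 𝔓 = 𝔓ˢ ; 𝔓ₗ = 𝔓ˢₗ ; 𝔓ᵣ = 𝔓ˢᵣ ; 𝔓-comm = 𝔓ˢ-comm
    ; SC1 = SC1ˢ ; SC2 = SC2ˢ }

  ↓-functor-isSpinal : IsSpinal lifted-spine SC (↓-functor C f)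
  ↓-functor-isSpinal = record
    { F-Ω = f-Ωˢ
    ; F-𝔓 = f-𝔓ˢ
    ; F-𝔓ₗ = λ g h → subst-subst-sym (f-𝔓ˢ g h)
    ; F-𝔓ᵣ = λ g h → subst-subst-sym (f-𝔓ˢ g h)
    }

_∘F_ : ∀ {o ℓ o' ℓ' o'' ℓ''} {C : Category o ℓ} {D : Category o' ℓ'}
         {E : Category o'' ℓ''} → Functor D E → Functor C D → Functor C E
F ∘F G = record
  { F₀ = λ X → F.F₀ (G.F₀ X)
  ; F₁ = λ k → F.F₁ (G.F₁ k)
  ; F-id = trans (cong F.F₁ G.F-id) F.F-id
  ; F-∘ = λ k l → trans (cong F.F₁ (G.F-∘ k l)) (F.F-∘ (G.F₁ k) (G.F₁ l))
  }
  where
  module F = Functor F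
  module G = Functor G

-- Hom-sets of Nat are propositions and its proxy pushouts are maxima of the
-- objects, so only the object equations of the composite need an argument.
SFunctor-∘-spinal : ∀ {o ℓ o' ℓ'} {C : Category o ℓ} {D : Category o' ℓ'}
                      {SC : Spine C} {SD : Spine D} →
                    SFunctor SD → SpinalFunctor SC SD → SFunctor SC
SFunctor-∘-spinal M G = record
  { functor = M.functor ∘F G.functor
  ; isSpinal = record
    { F-Ω = λ n → trans (cong M.F₀ (G.F-Ω n)) (M.F-Ω n)
    ; F-𝔓 = λ g h → trans (cong M.F₀ (G.F-𝔓 g h)) (M.F-𝔓 (G.F₁Ω g) (G.F₁Ω h))
    ; F-𝔓ₗ = λ _ _ → ≤-irrelevant _ _
    ; F-𝔓ᵣ = λ _ _ → ≤-irrelevant _ _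
    }
  }
  where
  module M where
    open SpinalFunctor M public
    open Functor functor public
    open IsSpinal isSpinal public
  module G where
    open SpinalFunctor G public
    open IsSpinal isSpinal public

theorem6p1 : ∀ {o ℓ s} (C : Category o ℓ) (SC : Spine C)
    (S : Set s) (f : S → Category.Obj C) →
    (∀ (n : ℕ) → Σ S λ X → f X ≡ Spine.Ω SC n) →
    (Z : ∀ {n X Y} (x : Category.Hom C (Spine.Ω SC n) (f X))
    (y : Category.Hom C (Spine.Ω SC n) (f Y)) → S) →
    (∀ {n X Y} (x : Category.Hom C (Spine.Ω SC n) (f X))
    (y : Category.Hom C (Spine.Ω SC n) (f Y)) →
    f (Z x y) ≡ Spine.𝔓 SC x y) →
    Σ (Spine (C ↓ f)) λ SS →
    IsSpinal SS SC (↓-functor C f) × (Measurable SC → Measurable SS)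
theorem6p1 C SC S f Ω-preimage Z f-Z =
  lifted-spine , ↓-functor-isSpinal ,
  λ M → SFunctor-∘-spinal M (record { functor = ↓-functor C f ; isSpinal = ↓-functor-isSpinal })
  where open Lift C SC S f Ω-preimage Z f-Z
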